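{- Let $\alpha,\beta\in\{ -1,0,1\}$. Let $\tilde C\in\{0,1\}^{\tilde K\times n}$ and $\hat C\in\{0,1\}^{\hat K\times n}$ be cost matrices of ordinal objectives. Then the matrix $$A=\begin{pmatrix}\alpha\,\tilde C & I_{\tilde K} & 0\\ \beta\,\hat C & 0 & I_{\hat K}\end{pmatrix}$$ is totally unimodular. This matrix is the constraint matrix, in standard form with slack variables, of the problem $\min \gamma f(x)$ s.t. $\alpha\tilde Cx\le\tilde b,\ \beta\hat Cx\le \hat b,\ x\in\{0,1\}^n$.
   Context: An ordinal objective on $n$ elements with $K$ ordered categories $\eta_1\prec\dots\prec\eta_K$ is given by an assignment $o:\{1,\dots,n\}\to\{\eta_1,\dots,\eta_K\}$. Its cost matrix $C\in\{0,1\}^{K\times n}$ has entries $C_{ji}=1$ if $j\le k$, where $o(i)=\eta_k$, and $C_{ji}=0$ otherwise. The matrices $\tilde C$ and $\hat C$ are cost matrices of two such ordinal objectives, with $\tilde K$ and $\hat K$ categories respectively. $I_m$ denotes the $m\times m$ identity matrix. A matrix is totally unimodular if every square submatrix has determinant in $\{0,1,-1\}$. -}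

module Defs where

open import Data.Nat using (ℕ; zero; suc; _+_)
open import Data.Fin using (Fin; zero; suc; toℕ; punchIn; splitAt; _≤_)
open import Data.Integer using (ℤ; +_; -_; _*_) renaming (_+_ to _+ℤ_)
open import Data.Sum using (_⊎_; inj₁; inj₂)
open import Data.Product using (_×_)
open import Data.Fin.Properties using (_≤?_)
open import Relation.Nullary using (yes; no)
open import Relation.Binary.PropositionalEquality using (_≡_)
open import Function.Definitions using (Injective)

Matrix : ℕ → ℕ → Set
Matrix m n = Fin m → Fin n → ℤ

∑ : ∀ {n} → (Fin n → ℤ) → ℤ
∑ {zero} f = + 0
∑ {suc n} f = f zero +ℤ ∑ (λ i → f (suc i))

sgn : ℕ → ℤ
sgn zero = + 1
sgn (suc k) = - sgn k

det : ∀ {k} → Matrix k k → ℤ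
det {zero} M = + 1
det {suc k} M =
  ∑ (λ j → sgn (toℕ j) * (M zero j * det (λ r c → M (suc r) (punchIn j c))))

submatrix : ∀ {m n k} → Matrix m n → (Fin k → Fin m) → (Fin k → Fin n) → Matrix k k
submatrix M ρ κ r c = M (ρ r) (κ c)

TotallyUnimodular : ∀ {m n} → Matrix m n → Set
TotallyUnimodular {m} {n} M =
  ∀ k (ρ : Fin k → Fin m) (κ : Fin k → Fin n) →
  Injective _≡_ _≡_ ρ → Injective _≡_ _≡_ κ →
  (det (submatrix M ρ κ) ≡ + 0) ⊎ (det (submatrix M ρ κ) ≡ + 1) ⊎ (det (submatrix M ρ κ) ≡ - (+ 1))

-- Ordinal objective on n elements with K ordered categories η_1 ≺ … ≺ η_K,
-- categories indexed 0-based by Fin K (η_{k+1} ↦ k).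
OrdinalObjective : ℕ → ℕ → Set
OrdinalObjective K n = Fin n → Fin K

costMatrix : ∀ {K n} → OrdinalObjective K n → Matrix K n
costMatrix o j i with j ≤? o i
... | yes _ = + 1
... | no _ = + 0

identity : ∀ {m} → Matrix m m
identity i j with i Data.Fin.≟ j
... | yes _ = + 1
... | no _ = + 0

-- The block matrix
--   ( α C̃  I  0 )
--   ( β Ĉ  0  I )
-- with rows Fin (K̃ + K̂) and columns Fin (n + (K̃ + K̂)).
blockMatrix : ∀ {K̃ K̂ n} → ℤ → ℤ → Matrix K̃ n → Matrix K̂ n →
              Matrix (K̃ + K̂) (n + (K̃ + K̂))
blockMatrix {K̃} {K̂} {n} α β C̃ Ĉ r c with splitAt K̃ r | splitAt n c
... | inj₁ r̃ | inj₁ x = α * C̃ r̃ x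
... | inj₂ r̂ | inj₁ x = β * Ĉ r̂ x
... | inj₁ r̃ | inj₂ s with splitAt K̃ s
...   | inj₁ s̃ = identity r̃ s̃
...   | inj₂ _ = + 0
blockMatrix {K̃} {K̂} {n} α β C̃ Ĉ r c | inj₂ r̂ | inj₂ s with splitAt K̃ s
...   | inj₁ _ = + 0
...   | inj₂ ŝ = identity r̂ ŝ

InSignSet : ℤ → Set
InSignSet a = (a ≡ - (+ 1)) ⊎ (a ≡ + 0) ⊎ (a ≡ + 1)

module Submission where

-- Order the rows of A by giving the top rows ranks below K̃ in reverse order and the bottom rows
-- ranks from K̃ on. Then every column of A is, up to sign, the indicator of an interval of ranks:
-- a cost column x covers the top rows t ≤ õ x and the bottom rows b ≤ ô x (nothing on a side whose
-- factor is 0), a slack column covers a single row. Square matrices of this kind have determinant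
-- 0 or ±1 by induction on the size: column operations leave a row of least rank with a single
-- nonzero entry, and the complementary minor is again of this kind.

open import Defs
open import Data.Empty using (⊥-elim)
open import Data.Fin as Fin
  using (Fin; zero; suc; toℕ; punchIn; punchOut; inject₁; fromℕ<; opposite; splitAt)
open import Data.Fin.Permutation.Components using (transpose)
import Data.Fin.Properties as Fin
open import Data.Integer using (ℤ; 0ℤ; 1ℤ; -1ℤ; +0; +[1+_]; -[1+_]; -_; _*_; _+_; _-_)
open import Data.Integer.Properties
  using ( *-assoc; *-identityˡ; *-identityʳ; *-zeroʳ; +-identityˡ; +-identityʳ
        ; neg-injective; neg-distrib-+; neg-distribˡ-*)
open import Data.Integer.Tactic.RingSolver using (solve-∀)
open import Data.Nat as ℕ using (ℕ; zero; suc; _≤_; _<_; _≤?_; _<?_; z≤n; s≤s)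
import Data.Nat.Properties as ℕ
open import Data.Product using (∃-syntax; _×_; _,_; proj₁; proj₂)
open import Data.Sum using (_⊎_; inj₁; inj₂; [_,_]′)
open import Data.Unit using (⊤; tt)
open import Function using (_∘_; const)
open import Relation.Binary.Definitions using (tri<; tri≈; tri>)
open import Relation.Binary.PropositionalEquality
open import Relation.Nullary using (¬_; Dec; yes; no)
open import Relation.Nullary.Decidable using (_×-dec_; ¬?; dec-true; dec-false)
open ≡-Reasoning

∑-cong : ∀ {n} {f g : Fin n → ℤ} → (∀ i → f i ≡ g i) → ∑ f ≡ ∑ g
∑-cong {zero} _ = refl
∑-cong {suc n} f≗g = cong₂ _+_ (f≗g zero) (∑-cong (f≗g ∘ suc))

∑-zero : ∀ {n} {f : Fin n → ℤ} → (∀ i → f i ≡ 0ℤ) → ∑ f ≡ 0ℤ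
∑-zero {zero} _ = refl
∑-zero {suc n} f≗0 = cong₂ _+_ (f≗0 zero) (∑-zero (f≗0 ∘ suc))

∑-distrib-+ : ∀ {n} (f g : Fin n → ℤ) → ∑ (λ i → f i + g i) ≡ ∑ f + ∑ g
∑-distrib-+ {zero} _ _ = refl
∑-distrib-+ {suc n} f g =
  trans (cong (f zero + g zero +_) (∑-distrib-+ (f ∘ suc) (g ∘ suc)))
        (interchange (f zero) (g zero) (∑ (f ∘ suc)) (∑ (g ∘ suc)))
  where
  interchange : ∀ a b c d → a + b + (c + d) ≡ a + c + (b + d)
  interchange = solve-∀

*-distribˡ-∑ : ∀ {n} c (f : Fin n → ℤ) → c * ∑ f ≡ ∑ (λ i → c * f i)
*-distribˡ-∑ {zero} c _ = *-zeroʳ c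
*-distribˡ-∑ {suc n} c f =
  trans (distrib c (f zero) (∑ (f ∘ suc))) (cong (c * f zero +_) (*-distribˡ-∑ c (f ∘ suc)))
  where
  distrib : ∀ a b d → a * (b + d) ≡ a * b + a * d
  distrib = solve-∀

neg-distrib-∑ : ∀ {n} (f : Fin n → ℤ) → - ∑ f ≡ ∑ (λ i → - f i)
neg-distrib-∑ {zero} _ = refl
neg-distrib-∑ {suc n} f =
  trans (neg-distrib-+ (f zero) (∑ (f ∘ suc))) (cong (- f zero +_) (neg-distrib-∑ (f ∘ suc)))

∑-punchIn : ∀ {n} (f : Fin (suc n) → ℤ) j → ∑ f ≡ f j + ∑ (f ∘ punchIn j)
∑-punchIn f zero = refl
∑-punchIn {suc n} f (suc j) =
  trans (cong (f zero +_) (∑-punchIn (f ∘ suc) j))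
        (swap (f zero) (f (suc j)) (∑ (f ∘ suc ∘ punchIn j)))
  where
  swap : ∀ a b c → a + (b + c) ≡ b + (a + c)
  swap = solve-∀

∑-single : ∀ {n} (f : Fin n → ℤ) j → (∀ i → i ≢ j → f i ≡ 0ℤ) → ∑ f ≡ f j
∑-single {suc n} f j f≗0 = begin
  ∑ f                      ≡⟨ ∑-punchIn f j ⟩
  f j + ∑ (f ∘ punchIn j)  ≡⟨ cong (f j +_) (∑-zero λ q → f≗0 (punchIn j q) (Fin.punchInᵢ≢i j q)) ⟩
  f j + 0ℤ                 ≡⟨ +-identityʳ (f j) ⟩
  f j                      ∎

∑-transpose : ∀ {n} {f g : Fin n → ℤ} {a b} → a ≢ b →
  f a ≡ g b → f b ≡ g a → (∀ i → i ≢ a → i ≢ b → f i ≡ g i) → ∑ f ≡ ∑ g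
∑-transpose {suc zero} {a = zero} {zero} a≢b _ _ _ = ⊥-elim (a≢b refl)
∑-transpose {suc (suc n)} {f} {g} {a} {b} a≢b fa≡gb fb≡ga f≗g = begin
  ∑ f                      ≡⟨ split f ⟩
  f a + (f b + ∑ (f ∘ ι))  ≡⟨ cong₂ (λ x y → x + (y + ∑ (f ∘ ι))) fa≡gb fb≡ga ⟩
  g b + (g a + ∑ (f ∘ ι))  ≡⟨ cong (λ s → g b + (g a + s)) (∑-cong λ q → f≗g (ι q) (ι≢a q) (ι≢b q)) ⟩
  g b + (g a + ∑ (g ∘ ι))  ≡⟨ swap (g b) (g a) (∑ (g ∘ ι)) ⟩
  g a + (g b + ∑ (g ∘ ι))  ≡⟨ split g ⟨
  ∑ g                      ∎
  where
  b′ = punchOut a≢b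
  ι : Fin n → Fin (suc (suc n))
  ι = punchIn a ∘ punchIn b′
  ι≢a : ∀ q → ι q ≢ a
  ι≢a q = Fin.punchInᵢ≢i a (punchIn b′ q)
  ι≢b : ∀ q → ι q ≢ b
  ι≢b q ιq≡b = Fin.punchInᵢ≢i b′ q
    (Fin.punchIn-injective a _ _ (trans ιq≡b (sym (Fin.punchIn-punchOut a≢b))))
  split : ∀ h → ∑ h ≡ h a + (h b + ∑ (h ∘ ι))
  split h = begin
    ∑ h                                   ≡⟨ ∑-punchIn h a ⟩
    h a + ∑ (h ∘ punchIn a)               ≡⟨ cong (h a +_) (∑-punchIn (h ∘ punchIn a) b′) ⟩
    h a + (h (punchIn a b′) + ∑ (h ∘ ι))
      ≡⟨ cong (λ x → h a + (h x + ∑ (h ∘ ι))) (Fin.punchIn-punchOut a≢b) ⟩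
    h a + (h b + ∑ (h ∘ ι))               ∎
  swap : ∀ x y z → x + (y + z) ≡ y + (x + z)
  swap = solve-∀

IsUnit : ℤ → Set
IsUnit x = x ≡ 1ℤ ⊎ x ≡ -1ℤ

ZeroOrUnit : ℤ → Set
ZeroOrUnit x = x ≡ 0ℤ ⊎ IsUnit x

IsUnit-* : ∀ {a b} → IsUnit a → IsUnit b → IsUnit (a * b)
IsUnit-* (inj₁ refl) (inj₁ refl) = inj₁ refl
IsUnit-* (inj₁ refl) (inj₂ refl) = inj₂ refl
IsUnit-* (inj₂ refl) (inj₁ refl) = inj₂ refl
IsUnit-* (inj₂ refl) (inj₂ refl) = inj₁ refl

IsUnit⇒square≡1 : ∀ {a} → IsUnit a → a * a ≡ 1ℤ
IsUnit⇒square≡1 (inj₁ refl) = refl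
IsUnit⇒square≡1 (inj₂ refl) = refl

IsUnit-sgn : ∀ k → IsUnit (sgn k)
IsUnit-sgn zero = inj₁ refl
IsUnit-sgn (suc k) with IsUnit-sgn k
... | inj₁ sk≡1 = inj₂ (cong -_ sk≡1)
... | inj₂ sk≡-1 = inj₁ (cong -_ sk≡-1)

ZeroOrUnit-* : ∀ {a x} → IsUnit a → ZeroOrUnit x → ZeroOrUnit (a * x)
ZeroOrUnit-* {a} _ (inj₁ refl) = inj₁ (*-zeroʳ a)
ZeroOrUnit-* a-unit (inj₂ x-unit) = inj₂ (IsUnit-* a-unit x-unit)

x≡-x⇒x≡0 : ∀ {x} → x ≡ - x → x ≡ 0ℤ
x≡-x⇒x≡0 {+0} _ = refl
x≡-x⇒x≡0 {+[1+ n ]} ()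
x≡-x⇒x≡0 { -[1+ n ]} ()

*-*-zeroʳ : ∀ a b {z} → z ≡ 0ℤ → a * (b * z) ≡ 0ℤ
*-*-zeroʳ a b refl = trans (cong (a *_) (*-zeroʳ b)) (*-zeroʳ a)

≡-or-≢ : ∀ {n} (i j : Fin n) → i ≡ j ⊎ i ≢ j
≡-or-≢ i j with i Fin.≟ j
... | yes i≡j = inj₁ i≡j
... | no i≢j = inj₂ i≢j

transpose-matchˡ : ∀ {n} (i j : Fin n) → transpose i j i ≡ j
transpose-matchˡ i j rewrite dec-true (i Fin.≟ i) refl = refl

transpose-matchʳ : ∀ {n} (i j : Fin n) → transpose i j j ≡ i
transpose-matchʳ i j with j Fin.≟ i
... | yes j≡i = j≡i
... | no _ rewrite dec-true (j Fin.≟ j) refl = refl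

transpose-other : ∀ {n} {i j k : Fin n} → k ≢ i → k ≢ j → transpose i j k ≡ k
transpose-other {i = i} {j} {k} k≢i k≢j
  rewrite dec-false (k Fin.≟ i) k≢i | dec-false (k Fin.≟ j) k≢j = refl

transpose-punchIn : ∀ {n} (p : Fin (suc n)) (i j k : Fin n) →
  transpose (punchIn p i) (punchIn p j) (punchIn p k) ≡ punchIn p (transpose i j k)
transpose-punchIn p i j k with ≡-or-≢ k i | ≡-or-≢ k j
... | inj₁ refl | _ =
  trans (transpose-matchˡ (punchIn p i) (punchIn p j)) (cong (punchIn p) (sym (transpose-matchˡ i j)))
... | inj₂ _ | inj₁ refl =
  trans (transpose-matchʳ (punchIn p i) (punchIn p j)) (cong (punchIn p) (sym (transpose-matchʳ i j)))
... | inj₂ k≢i | inj₂ k≢j =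
  trans (transpose-other (k≢i ∘ Fin.punchIn-injective p k i) (k≢j ∘ Fin.punchIn-injective p k j))
        (cong (punchIn p) (sym (transpose-other k≢i k≢j)))

punchIn-≢-punchOut : ∀ {n} {j c : Fin (suc n)} (j≢c : j ≢ c) {e} →
  e ≢ punchOut j≢c → punchIn j e ≢ c
punchIn-≢-punchOut {j = j} j≢c {e} e≢c′ je≡c =
  e≢c′ (Fin.punchIn-injective j e _ (trans je≡c (sym (Fin.punchIn-punchOut j≢c))))

data Adjacent : ∀ {n} → Fin n → Fin n → Set where
  zero-one : ∀ {n} → Adjacent {suc (suc n)} zero (suc zero)
  suc-suc  : ∀ {n} {a b : Fin n} → Adjacent a b → Adjacent (suc a) (suc b)

toℕ⇒Adjacent : ∀ {n} {a b : Fin n} → toℕ b ≡ suc (toℕ a) → Adjacent a b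
toℕ⇒Adjacent {a = zero} {suc zero} _ = zero-one
toℕ⇒Adjacent {a = suc a} {suc b} eq = suc-suc (toℕ⇒Adjacent (ℕ.suc-injective eq))
toℕ⇒Adjacent {a = zero} {suc (suc b)} ()

Adjacent⇒≢ : ∀ {n} {a b : Fin n} → Adjacent a b → a ≢ b
Adjacent⇒≢ zero-one ()
Adjacent⇒≢ (suc-suc adj) = Adjacent⇒≢ adj ∘ Fin.suc-injective

Adjacent-sgnˡ : ∀ {n} {a b : Fin n} → Adjacent a b → sgn (toℕ a) ≡ - sgn (toℕ b)
Adjacent-sgnˡ zero-one = refl
Adjacent-sgnˡ (suc-suc adj) = cong -_ (Adjacent-sgnˡ adj)

Adjacent-sgnʳ : ∀ {n} {a b : Fin n} → Adjacent a b → sgn (toℕ b) ≡ - sgn (toℕ a)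
Adjacent-sgnʳ zero-one = refl
Adjacent-sgnʳ (suc-suc adj) = cong -_ (Adjacent-sgnʳ adj)

Adjacent-punchOut : ∀ {n} {i a b : Fin (suc n)} (i≢a : i ≢ a) (i≢b : i ≢ b) →
  Adjacent a b → Adjacent (punchOut i≢a) (punchOut i≢b)
Adjacent-punchOut {i = zero} i≢a _ zero-one = ⊥-elim (i≢a refl)
Adjacent-punchOut {i = suc zero} _ i≢b zero-one = ⊥-elim (i≢b refl)
Adjacent-punchOut {suc (suc n)} {i = suc (suc i)} _ _ zero-one = zero-one
Adjacent-punchOut {i = zero} _ _ (suc-suc adj) = adj
Adjacent-punchOut {suc n} {i = suc i} i≢a i≢b (suc-suc adj) =
  suc-suc (Adjacent-punchOut (i≢a ∘ cong suc) (i≢b ∘ cong suc) adj)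

punchIn-Adjacent : ∀ {n} {a b : Fin (suc n)} → Adjacent a b → ∀ c →
  punchIn a c ≡ punchIn b c ⊎ (punchIn a c ≡ b × punchIn b c ≡ a)
punchIn-Adjacent zero-one zero = inj₂ (refl , refl)
punchIn-Adjacent zero-one (suc c) = inj₁ refl
punchIn-Adjacent (suc-suc adj) zero = inj₁ refl
punchIn-Adjacent {suc n} (suc-suc adj) (suc c) with punchIn-Adjacent adj c
... | inj₁ eq = inj₁ (cong suc eq)
... | inj₂ (eqᵃ , eqᵇ) = inj₂ (cong suc eqᵃ , cong suc eqᵇ)

transpose-punchIn-Adjacent : ∀ {n} {a b : Fin (suc n)} → Adjacent a b → ∀ c →
  transpose a b (punchIn a c) ≡ punchIn b c × transpose a b (punchIn b c) ≡ punchIn a c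
transpose-punchIn-Adjacent {a = a} {b} adj c with punchIn-Adjacent adj c
... | inj₁ eq =
  let fixed = transpose-other (Fin.punchInᵢ≢i a c) (subst (_≢ b) (sym eq) (Fin.punchInᵢ≢i b c))
  in trans fixed eq , trans (cong (transpose a b) (sym eq)) fixed
... | inj₂ (eqᵃ , eqᵇ) =
  trans (cong (transpose a b) eqᵃ) (trans (transpose-matchʳ a b) (sym eqᵇ)) ,
  trans (cong (transpose a b) eqᵇ) (trans (transpose-matchˡ a b) (sym eqᵃ))

-- dual j q is the position of j among the indices other than punchIn j q.
dual : ∀ {n} → Fin (suc (suc n)) → Fin (suc n) → Fin (suc n)
dual zero q = zero
dual (suc j) zero = j
dual {suc n} (suc j) (suc q) = suc (dual j q)

punchIn-dual : ∀ {n} (j : Fin (suc (suc n))) q → punchIn (punchIn j q) (dual j q) ≡ j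
punchIn-dual zero q = refl
punchIn-dual (suc j) zero = refl
punchIn-dual {suc n} (suc j) (suc q) = cong suc (punchIn-dual j q)

punchIn-punchIn-dual : ∀ {n} (j : Fin (suc (suc n))) q c →
  punchIn (punchIn j q) (punchIn (dual j q) c) ≡ punchIn j (punchIn q c)
punchIn-punchIn-dual zero q c = refl
punchIn-punchIn-dual (suc j) zero c = refl
punchIn-punchIn-dual {suc n} (suc j) (suc q) zero = refl
punchIn-punchIn-dual {suc n} (suc j) (suc q) (suc c) = cong suc (punchIn-punchIn-dual j q c)

sgn-dual : ∀ {n} (j : Fin (suc (suc n))) q →
  sgn (toℕ (punchIn j q)) * sgn (toℕ (dual j q)) ≡ - (sgn (toℕ j) * sgn (toℕ q))
sgn-dual zero q = flip (sgn (toℕ q))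
  where
  flip : ∀ x → - x * 1ℤ ≡ - (1ℤ * x)
  flip = solve-∀
sgn-dual (suc j) zero = flip (sgn (toℕ j))
  where
  flip : ∀ x → 1ℤ * x ≡ - (- x * 1ℤ)
  flip = solve-∀
sgn-dual {suc n} (suc j) (suc q) = begin
  - a * - b      ≡⟨ neg-square a b ⟩
  a * b          ≡⟨ sgn-dual j q ⟩
  - (c * d)      ≡⟨ cong -_ (neg-square c d) ⟨
  - (- c * - d)  ∎
  where
  a = sgn (toℕ (punchIn j q))
  b = sgn (toℕ (dual j q))
  c = sgn (toℕ j)
  d = sgn (toℕ q)
  neg-square : ∀ x y → - x * - y ≡ x * y
  neg-square = solve-∀

-- Determinants

minor : ∀ {n} → Matrix (suc n) (suc n) → Fin (suc n) → Fin (suc n) → Matrix n n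
minor M i j = submatrix M (punchIn i) (punchIn j)

laplaceTerm : ∀ {n} → Matrix (suc n) (suc n) → Fin (suc n) → ℤ
laplaceTerm M j = sgn (toℕ j) * (M zero j * det (minor M zero j))

det-cong : ∀ {n} {A B : Matrix n n} → (∀ r c → A r c ≡ B r c) → det A ≡ det B
det-cong {zero} _ = refl
det-cong {suc n} A≗B = ∑-cong λ j →
  cong₂ (λ x d → sgn (toℕ j) * (x * d)) (A≗B zero j) (det-cong λ r c → A≗B (suc r) (punchIn j c))

det-transpose-Adjacent : ∀ {n} {a b : Fin n} → Adjacent a b → (M : Matrix n n) →
  det (λ r c → M r (transpose a b c)) ≡ - det M
det-transpose-Adjacent {suc n} {a} {b} adj M = begin
  ∑ (laplaceTerm A)            ≡⟨ ∑-transpose (Adjacent⇒≢ adj) term-a term-b term-other ⟩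
  ∑ (λ j → - laplaceTerm M j)  ≡⟨ neg-distrib-∑ (laplaceTerm M) ⟨
  - det M                      ∎
  where
  A : Matrix (suc n) (suc n)
  A r c = M r (transpose a b c)
  term-a : laplaceTerm A a ≡ - laplaceTerm M b
  term-a = begin
    sgn (toℕ a) * (M zero (transpose a b a) * det (minor A zero a))
      ≡⟨ cong₂ (λ x d → sgn (toℕ a) * (M zero x * d)) (transpose-matchˡ a b)
               (det-cong λ r c → cong (M (suc r)) (proj₁ (transpose-punchIn-Adjacent adj c))) ⟩
    sgn (toℕ a) * (M zero b * det (minor M zero b))
      ≡⟨ cong (_* (M zero b * det (minor M zero b))) (Adjacent-sgnˡ adj) ⟩
    - sgn (toℕ b) * (M zero b * det (minor M zero b))
      ≡⟨ neg-distribˡ-* (sgn (toℕ b)) _ ⟨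
    - laplaceTerm M b ∎
  term-b : laplaceTerm A b ≡ - laplaceTerm M a
  term-b = begin
    sgn (toℕ b) * (M zero (transpose a b b) * det (minor A zero b))
      ≡⟨ cong₂ (λ x d → sgn (toℕ b) * (M zero x * d)) (transpose-matchʳ a b)
               (det-cong λ r c → cong (M (suc r)) (proj₂ (transpose-punchIn-Adjacent adj c))) ⟩
    sgn (toℕ b) * (M zero a * det (minor M zero a))
      ≡⟨ cong (_* (M zero a * det (minor M zero a))) (Adjacent-sgnʳ adj) ⟩
    - sgn (toℕ a) * (M zero a * det (minor M zero a))
      ≡⟨ neg-distribˡ-* (sgn (toℕ a)) _ ⟨
    - laplaceTerm M a ∎
  term-other : ∀ j → j ≢ a → j ≢ b → laplaceTerm A j ≡ - laplaceTerm M j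
  term-other j j≢a j≢b = begin
    sgn (toℕ j) * (M zero (transpose a b j) * det (minor A zero j))
      ≡⟨ cong₂ (λ x d → sgn (toℕ j) * (M zero x * d)) (transpose-other j≢a j≢b) minor-transposed ⟩
    sgn (toℕ j) * (M zero j * - det (minor M zero j))
      ≡⟨ pull-neg (sgn (toℕ j)) (M zero j) (det (minor M zero j)) ⟩
    - laplaceTerm M j ∎
    where
    pull-neg : ∀ s x d → s * (x * - d) ≡ - (s * (x * d))
    pull-neg = solve-∀
    a′ = punchOut j≢a
    b′ = punchOut j≢b
    punchIn-transposed : ∀ c → transpose a b (punchIn j c) ≡ punchIn j (transpose a′ b′ c)
    punchIn-transposed c =
      trans (cong₂ (λ x y → transpose x y (punchIn j c))
                   (sym (Fin.punchIn-punchOut j≢a)) (sym (Fin.punchIn-punchOut j≢b)))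
            (transpose-punchIn j a′ b′ c)
    minor-transposed : det (minor A zero j) ≡ - det (minor M zero j)
    minor-transposed =
      trans (det-cong λ r c → cong (M (suc r)) (punchIn-transposed c))
            (det-transpose-Adjacent (Adjacent-punchOut j≢a j≢b adj) (minor M zero j))

transpose-equalColumns : ∀ {m n} (M : Matrix m n) {a b} → (∀ r → M r a ≡ M r b) →
  ∀ r c → M r (transpose a b c) ≡ M r c
transpose-equalColumns M {a} {b} a≡b r c with ≡-or-≢ c a | ≡-or-≢ c b
... | inj₁ refl | _ = trans (cong (M r) (transpose-matchˡ c b)) (sym (a≡b r))
... | inj₂ _ | inj₁ refl = trans (cong (M r) (transpose-matchʳ a c)) (a≡b r)
... | inj₂ c≢a | inj₂ c≢b = cong (M r) (transpose-other c≢a c≢b)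

det-equalAdjacentColumns : ∀ {n} {a b : Fin n} → Adjacent a b → (M : Matrix n n) →
  (∀ r → M r a ≡ M r b) → det M ≡ 0ℤ
det-equalAdjacentColumns adj M a≡b =
  x≡-x⇒x≡0 (trans (sym (det-cong (transpose-equalColumns M a≡b))) (det-transpose-Adjacent adj M))

-- Swapping column b with its left neighbour b′ brings the equal columns one step closer.
det-equalColumns-apart : ∀ d {n} (M : Matrix n n) {a b : Fin n} → suc (toℕ a ℕ.+ d) ≡ toℕ b →
  (∀ r → M r a ≡ M r b) → det M ≡ 0ℤ
det-equalColumns-apart zero M {a} dist a≡b =
  det-equalAdjacentColumns (toℕ⇒Adjacent (trans (sym dist) (cong suc (ℕ.+-identityʳ (toℕ a))))) M a≡b
det-equalColumns-apart (suc d) M {a} {suc b₀} dist a≡b =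
  neg-injective (trans (sym (det-transpose-Adjacent adj M)) (det-equalColumns-apart d N dist′ N-a≡b′))
  where
  b′ = inject₁ b₀
  adj : Adjacent b′ (suc b₀)
  adj = toℕ⇒Adjacent (cong suc (sym (Fin.toℕ-inject₁ b₀)))
  dist′ : suc (toℕ a ℕ.+ d) ≡ toℕ b′
  dist′ = trans (sym (ℕ.+-suc (toℕ a) d)) (trans (ℕ.suc-injective dist) (sym (Fin.toℕ-inject₁ b₀)))
  N : Matrix _ _
  N r c = M r (transpose b′ (suc b₀) c)
  a≢b′ : a ≢ b′
  a≢b′ a≡b′ = ℕ.m≢1+m+n (toℕ a) (trans (cong toℕ a≡b′) (sym dist′))
  a≢b : a ≢ suc b₀
  a≢b a≡b = ℕ.m≢1+m+n (toℕ a) (trans (cong toℕ a≡b) (sym dist))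
  N-a≡b′ : ∀ r → N r a ≡ N r b′
  N-a≡b′ r = trans (cong (M r) (transpose-other a≢b′ a≢b))
                   (trans (a≡b r) (cong (M r) (sym (transpose-matchˡ b′ (suc b₀)))))

det-equalColumns : ∀ {n} (M : Matrix n n) {a b : Fin n} → a ≢ b →
  (∀ r → M r a ≡ M r b) → det M ≡ 0ℤ
det-equalColumns M {a} {b} a≢b a≡b with ℕ.<-cmp (toℕ a) (toℕ b)
... | tri< a<b _ _ = det-equalColumns-apart _ M (proj₂ (ℕ.m≤n⇒∃[o]m+o≡n a<b)) a≡b
... | tri≈ _ a≡b′ _ = ⊥-elim (a≢b (Fin.toℕ-injective a≡b′))
... | tri> _ _ b<a = det-equalColumns-apart _ M (proj₂ (ℕ.m≤n⇒∃[o]m+o≡n b<a)) (sym ∘ a≡b)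

det-linearColumn : ∀ {n} (A B C : Matrix n n) (c : Fin n) (t : ℤ) →
  (∀ r j → j ≢ c → A r j ≡ B r j) → (∀ r j → j ≢ c → C r j ≡ B r j) →
  (∀ r → A r c ≡ B r c + t * C r c) → det A ≡ det B + t * det C
det-linearColumn {suc n} A B C c t A≗B C≗B A-c = begin
  ∑ (laplaceTerm A)                                ≡⟨ ∑-cong term ⟩
  ∑ (λ j → laplaceTerm B j + t * laplaceTerm C j)  ≡⟨ ∑-distrib-+ (laplaceTerm B) (_*_ t ∘ laplaceTerm C) ⟩
  det B + ∑ (λ j → t * laplaceTerm C j)            ≡⟨ cong (det B +_) (*-distribˡ-∑ t (laplaceTerm C)) ⟨
  det B + t * det C                                ∎
  where
  term : ∀ j → laplaceTerm A j ≡ laplaceTerm B j + t * laplaceTerm C j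
  term j with ≡-or-≢ j c
  ... | inj₁ refl = begin
    s * (A zero j * det (minor A zero j))
      ≡⟨ cong₂ (λ x d → s * (x * d)) (A-c zero) minorA≡minorB ⟩
    s * ((B zero j + t * C zero j) * dB)
      ≡⟨ distrib t s (B zero j) (C zero j) dB ⟩
    s * (B zero j * dB) + t * (s * (C zero j * dB))
      ≡⟨ cong (λ d → s * (B zero j * dB) + t * (s * (C zero j * d))) minorC≡minorB ⟨
    laplaceTerm B j + t * laplaceTerm C j ∎
    where
    s = sgn (toℕ j)
    dB = det (minor B zero j)
    distrib : ∀ t s x y d → s * ((x + t * y) * d) ≡ s * (x * d) + t * (s * (y * d))
    distrib = solve-∀
    minorA≡minorB : det (minor A zero j) ≡ dB
    minorA≡minorB = det-cong λ r e → A≗B (suc r) (punchIn j e) (Fin.punchInᵢ≢i j e)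
    minorC≡minorB : det (minor C zero j) ≡ dB
    minorC≡minorB = det-cong λ r e → C≗B (suc r) (punchIn j e) (Fin.punchInᵢ≢i j e)
  ... | inj₂ j≢c = begin
    s * (A zero j * det (minor A zero j))
      ≡⟨ cong₂ (λ x d → s * (x * d)) (A≗B zero j j≢c) minor-linear ⟩
    s * (B zero j * (dB + t * dC))
      ≡⟨ distrib t s (B zero j) dB dC ⟩
    s * (B zero j * dB) + t * (s * (B zero j * dC))
      ≡⟨ cong (λ x → s * (B zero j * dB) + t * (s * (x * dC))) (C≗B zero j j≢c) ⟨
    laplaceTerm B j + t * laplaceTerm C j ∎
    where
    s = sgn (toℕ j)
    dB = det (minor B zero j)
    dC = det (minor C zero j)
    distrib : ∀ t s x d d′ → s * (x * (d + t * d′)) ≡ s * (x * d) + t * (s * (x * d′))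
    distrib = solve-∀
    minor-linear : det (minor A zero j) ≡ dB + t * dC
    minor-linear = det-linearColumn (minor A zero j) (minor B zero j) (minor C zero j) (punchOut j≢c) t
      (λ r e e≢c′ → A≗B (suc r) (punchIn j e) (punchIn-≢-punchOut j≢c e≢c′))
      (λ r e e≢c′ → C≗B (suc r) (punchIn j e) (punchIn-≢-punchOut j≢c e≢c′))
      (λ r → subst (λ x → A (suc r) x ≡ B (suc r) x + t * C (suc r) x)
                   (sym (Fin.punchIn-punchOut j≢c)) (A-c (suc r)))

det-addColumnMultiple : ∀ {n} (A B : Matrix n n) {c j : Fin n} → c ≢ j → (t : ℤ) →
  (∀ r x → x ≢ c → A r x ≡ B r x) → (∀ r → A r c ≡ B r c + t * B r j) → det A ≡ det B
det-addColumnMultiple A B {c} {j} c≢j t A≗B A-c = begin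
  det A              ≡⟨ det-linearColumn A B C c t A≗B C≗B A-c′ ⟩
  det B + t * det C  ≡⟨ cong (λ d → det B + t * d) (det-equalColumns C c≢j C-c≡C-j) ⟩
  det B + t * 0ℤ     ≡⟨ cong (det B +_) (*-zeroʳ t) ⟩
  det B + 0ℤ         ≡⟨ +-identityʳ (det B) ⟩
  det B              ∎
  where
  C : Matrix _ _
  C r x with ≡-or-≢ x c
  ... | inj₁ _ = B r j
  ... | inj₂ _ = B r x
  C-c : ∀ r → C r c ≡ B r j
  C-c r with ≡-or-≢ c c
  ... | inj₁ _ = refl
  ... | inj₂ c≢c = ⊥-elim (c≢c refl)
  C≗B : ∀ r x → x ≢ c → C r x ≡ B r x
  C≗B r x x≢c with ≡-or-≢ x c
  ... | inj₁ x≡c = ⊥-elim (x≢c x≡c)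
  ... | inj₂ _ = refl
  A-c′ : ∀ r → A r c ≡ B r c + t * C r c
  A-c′ r = trans (A-c r) (cong (λ x → B r c + t * x) (sym (C-c r)))
  C-c≡C-j : ∀ r → C r c ≡ C r j
  C-c≡C-j r = trans (C-c r) (sym (C≗B r j (c≢j ∘ sym)))

addColumnMultiples : ∀ {n} → Matrix n n → Fin n → (Fin n → ℤ) → Matrix n n
addColumnMultiples M j f r c = M r c + f c * M r j

clearAt : ∀ {n} → Fin n → (Fin n → ℤ) → Fin n → ℤ
clearAt c₀ f c with ≡-or-≢ c c₀
... | inj₁ _ = 0ℤ
... | inj₂ _ = f c

clearAt-self : ∀ {n} (c₀ : Fin n) f → clearAt c₀ f c₀ ≡ 0ℤ
clearAt-self c₀ f with ≡-or-≢ c₀ c₀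
... | inj₁ _ = refl
... | inj₂ c₀≢c₀ = ⊥-elim (c₀≢c₀ refl)

clearAt-other : ∀ {n} {c₀ c : Fin n} f → c ≢ c₀ → clearAt c₀ f c ≡ f c
clearAt-other {c₀ = c₀} {c} f c≢c₀ with ≡-or-≢ c c₀
... | inj₁ c≡c₀ = ⊥-elim (c≢c₀ c≡c₀)
... | inj₂ _ = refl

det-addColumnMultiples-clearAt : ∀ {n} (M : Matrix n n) j (f : Fin n → ℤ) → f j ≡ 0ℤ → ∀ c₀ →
  det (addColumnMultiples M j f) ≡ det (addColumnMultiples M j (clearAt c₀ f))
det-addColumnMultiples-clearAt M j f fj≡0 c₀ with ≡-or-≢ c₀ j
... | inj₁ c₀≡j = det-cong λ r c → cong (λ x → M r c + x * M r j) (f≗f′ c)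
  where
  f≗f′ : ∀ c → f c ≡ clearAt c₀ f c
  f≗f′ c with ≡-or-≢ c c₀
  ... | inj₁ c≡c₀ = trans (cong f (trans c≡c₀ c₀≡j)) fj≡0
  ... | inj₂ _ = refl
... | inj₂ c₀≢j = det-addColumnMultiple _ _ c₀≢j (f c₀)
  (λ r c c≢c₀ → cong (λ x → M r c + x * M r j) (sym (clearAt-other f c≢c₀)))
  (λ r → begin
    M r c₀ + f c₀ * M r j
      ≡⟨ pad (M r c₀) (M r j) (f c₀) ⟩
    (M r c₀ + 0ℤ * M r j) + f c₀ * (M r j + 0ℤ * M r j)
      ≡⟨ cong₂ (λ x y → (M r c₀ + x * M r j) + f c₀ * (M r j + y * M r j))
               (clearAt-self c₀ f) (trans (clearAt-other f (c₀≢j ∘ sym)) fj≡0) ⟨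
    (M r c₀ + f′ c₀ * M r j) + f c₀ * (M r j + f′ j * M r j) ∎)
  where
  f′ = clearAt c₀ f
  pad : ∀ x y t → x + t * y ≡ (x + 0ℤ * y) + t * (y + 0ℤ * y)
  pad = solve-∀

det-addColumnMultiples : ∀ {n} (M : Matrix n n) j (f : Fin n → ℤ) → f j ≡ 0ℤ →
  det (addColumnMultiples M j f) ≡ det M
det-addColumnMultiples {n} M j f fj≡0 =
  supportedBelow n f fj≡0 (λ c n≤c → ⊥-elim (ℕ.<⇒≱ (Fin.toℕ<n c) n≤c))
  where
  supportedBelow : ∀ m (g : Fin n → ℤ) → g j ≡ 0ℤ → (∀ c → m ≤ toℕ c → g c ≡ 0ℤ) →
    det (addColumnMultiples M j g) ≡ det M
  supportedBelow zero g _ g≗0 =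
    det-cong λ r c → trans (cong (λ x → M r c + x * M r j) (g≗0 c z≤n)) (+-identityʳ (M r c))
  supportedBelow (suc m) g gj≡0 g≗0 with m <? n
  ... | no m≮n = supportedBelow m g gj≡0 λ c m≤c → ⊥-elim (m≮n (ℕ.≤-<-trans m≤c (Fin.toℕ<n c)))
  ... | yes m<n = trans (det-addColumnMultiples-clearAt M j g gj≡0 c₀) (supportedBelow m g′ g′j≡0 g′≗0)
    where
    c₀ = fromℕ< m<n
    g′ = clearAt c₀ g
    g′≗0 : ∀ c → m ≤ toℕ c → g′ c ≡ 0ℤ
    g′≗0 c m≤c with ≡-or-≢ c c₀
    ... | inj₁ _ = refl
    ... | inj₂ c≢c₀ = g≗0 c (ℕ.≤∧≢⇒< m≤c λ m≡c →
      c≢c₀ (Fin.toℕ-injective (trans (sym m≡c) (sym (Fin.toℕ-fromℕ< m<n)))))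
    g′j≡0 : g′ j ≡ 0ℤ
    g′j≡0 with ≡-or-≢ j c₀
    ... | inj₁ _ = refl
    ... | inj₂ _ = gj≡0

det-singleEntryRow : ∀ {n} (M : Matrix (suc n) (suc n)) (i j : Fin (suc n)) →
  (∀ c → c ≢ j → M i c ≡ 0ℤ) → det M ≡ sgn (toℕ i) * sgn (toℕ j) * (M i j * det (minor M i j))
det-singleEntryRow M zero j row-i = begin
  ∑ (laplaceTerm M)  ≡⟨ ∑-single (laplaceTerm M) j vanish ⟩
  laplaceTerm M j    ≡⟨ cong (_* (M zero j * det (minor M zero j))) (*-identityˡ (sgn (toℕ j))) ⟨
  1ℤ * sgn (toℕ j) * (M zero j * det (minor M zero j)) ∎
  where
  vanish : ∀ c → c ≢ j → laplaceTerm M c ≡ 0ℤ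
  vanish c c≢j = trans (cong (λ x → sgn (toℕ c) * (x * det (minor M zero c))) (row-i c c≢j))
                       (*-zeroʳ (sgn (toℕ c)))
det-singleEntryRow {suc n} M (suc i) j row-i = begin
  ∑ (laplaceTerm M)                                     ≡⟨ ∑-punchIn (laplaceTerm M) j ⟩
  laplaceTerm M j + ∑ (laplaceTerm M ∘ punchIn j)       ≡⟨ cong₂ _+_ term-j (∑-cong term-other) ⟩
  0ℤ + ∑ (λ q → κ * laplaceTerm (minor M (suc i) j) q)  ≡⟨ +-identityˡ _ ⟩
  ∑ (λ q → κ * laplaceTerm (minor M (suc i) j) q)       ≡⟨ *-distribˡ-∑ κ (laplaceTerm (minor M (suc i) j)) ⟨
  κ * det (minor M (suc i) j)                           ≡⟨ *-assoc (- sgn (toℕ i) * sgn (toℕ j)) _ _ ⟩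
  - sgn (toℕ i) * sgn (toℕ j) * (M (suc i) j * det (minor M (suc i) j)) ∎
  where
  κ = - sgn (toℕ i) * sgn (toℕ j) * M (suc i) j
  term-j : laplaceTerm M j ≡ 0ℤ
  term-j = *-*-zeroʳ (sgn (toℕ j)) (M zero j) minor-vanishes
    where
    minor-vanishes : det (minor M zero j) ≡ 0ℤ
    minor-vanishes =
      trans (det-singleEntryRow (minor M zero j) i zero λ c _ → row-i (punchIn j c) (Fin.punchInᵢ≢i j c))
            (trans (cong (λ x → sgn (toℕ i) * 1ℤ * (x * det (minor (minor M zero j) i zero)))
                         (row-i (punchIn j zero) (Fin.punchInᵢ≢i j zero)))
                   (*-zeroʳ (sgn (toℕ i) * 1ℤ)))
  term-other : ∀ q → laplaceTerm M (punchIn j q) ≡ κ * laplaceTerm (minor M (suc i) j) q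
  term-other q = begin
    sgn (toℕ j′) * (M zero j′ * det (minor M zero j′))
      ≡⟨ cong (λ d → sgn (toℕ j′) * (M zero j′ * d)) expand ⟩
    sgn (toℕ j′) * (M zero j′ * (sgn (toℕ i) * sgn (toℕ p) * (M (suc i) j * D)))
      ≡⟨ regroup (sgn (toℕ j′)) (sgn (toℕ p)) (sgn (toℕ i)) (sgn (toℕ j)) (sgn (toℕ q))
                 (M zero j′) (M (suc i) j) D (sgn-dual j q) ⟩
    κ * (sgn (toℕ q) * (M zero j′ * D)) ∎
    where
    j′ = punchIn j q
    p = dual j q
    D = det (minor (minor M (suc i) j) zero q)
    row-i′ : ∀ c → c ≢ p → M (suc i) (punchIn j′ c) ≡ 0ℤ
    row-i′ c c≢p = row-i (punchIn j′ c) λ eq →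
      c≢p (Fin.punchIn-injective j′ c p (trans eq (sym (punchIn-dual j q))))
    expand : det (minor M zero j′) ≡ sgn (toℕ i) * sgn (toℕ p) * (M (suc i) j * D)
    expand =
      trans (det-singleEntryRow (minor M zero j′) i p row-i′)
            (cong₂ (λ x d → sgn (toℕ i) * sgn (toℕ p) * (x * d))
                   (cong (M (suc i)) (punchIn-dual j q))
                   (det-cong λ r c → cong (M (suc (punchIn i r))) (punchIn-punchIn-dual j q c)))
    regroup : ∀ s′ sp si sj sq m₀ m D → s′ * sp ≡ - (sj * sq) →
      s′ * (m₀ * (si * sp * (m * D))) ≡ (- si * sj * m) * (sq * (m₀ * D))
    regroup s′ sp si sj sq m₀ m D sign = begin
      s′ * (m₀ * (si * sp * (m * D)))    ≡⟨ shuffle₁ s′ sp si m₀ m D ⟩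
      (s′ * sp) * (si * m₀ * m * D)      ≡⟨ cong (_* (si * m₀ * m * D)) sign ⟩
      - (sj * sq) * (si * m₀ * m * D)    ≡⟨ shuffle₂ sj sq si m₀ m D ⟩
      (- si * sj * m) * (sq * (m₀ * D))  ∎
      where
      shuffle₁ : ∀ s′ sp si m₀ m D →
        s′ * (m₀ * (si * sp * (m * D))) ≡ (s′ * sp) * (si * m₀ * m * D)
      shuffle₁ = solve-∀
      shuffle₂ : ∀ sj sq si m₀ m D →
        - (sj * sq) * (si * m₀ * m * D) ≡ (- si * sj * m) * (sq * (m₀ * D))
      shuffle₂ = solve-∀

det-zeroRow : ∀ {n} (M : Matrix n n) i → (∀ c → M i c ≡ 0ℤ) → det M ≡ 0ℤ
det-zeroRow {suc n} M i row-i =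
  trans (det-singleEntryRow M i zero λ c _ → row-i c)
        (trans (cong (λ x → sgn (toℕ i) * 1ℤ * (x * det (minor M i zero))) (row-i zero))
               (*-zeroʳ (sgn (toℕ i) * 1ℤ)))

-- Interval matrices

minimumOn : ∀ {n} {P : Fin n → Set} → (∀ c → Dec (P c)) → (f : Fin n → ℕ) →
  (∀ c → ¬ P c) ⊎ ∃[ j ] (P j × (∀ c → P c → f j ≤ f c))
minimumOn {zero} _ _ = inj₁ λ ()
minimumOn {suc n} P? f with P? zero | minimumOn (P? ∘ suc) (f ∘ suc)
... | no ¬P₀ | inj₁ none = inj₁ λ { zero → ¬P₀ ; (suc c) → none c }
... | no ¬P₀ | inj₂ (j , Pj , j-min) =
  inj₂ (suc j , Pj , λ { zero P₀ → ⊥-elim (¬P₀ P₀) ; (suc c) → j-min c })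
... | yes P₀ | inj₁ none =
  inj₂ (zero , P₀ , λ { zero _ → ℕ.≤-refl ; (suc c) Pc → ⊥-elim (none c Pc) })
... | yes P₀ | inj₂ (j , Pj , j-min) with f zero ≤? f (suc j)
...   | yes f₀≤fj =
  inj₂ (zero , P₀ , λ { zero _ → ℕ.≤-refl ; (suc c) Pc → ℕ.≤-trans f₀≤fj (j-min c Pc) })
...   | no f₀≰fj = inj₂ (suc j , Pj , λ { zero _ → ℕ.<⇒≤ (ℕ.≰⇒> f₀≰fj) ; (suc c) → j-min c })

minimum : ∀ {n} (f : Fin (suc n) → ℕ) → ∃[ i ] (∀ c → f i ≤ f c)
minimum f with minimumOn {P = λ _ → ⊤} (λ _ → yes tt) f
... | inj₁ none = ⊥-elim (none zero tt)
... | inj₂ (i , _ , i-min) = i , λ c → i-min c tt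

_∈[_,_⟩ : ℕ → ℕ → ℕ → Set
x ∈[ a , b ⟩ = a ≤ x × x < b

_∈?[_,_⟩ : ∀ x a b → Dec (x ∈[ a , b ⟩)
x ∈?[ a , b ⟩ = (a ≤? x) ×-dec (x <? b)

indicator : ℕ → ℕ → ℕ → ℤ
indicator a b x with x ∈?[ a , b ⟩
... | yes _ = 1ℤ
... | no _ = 0ℤ

indicator-∈ : ∀ {a b x} → x ∈[ a , b ⟩ → indicator a b x ≡ 1ℤ
indicator-∈ {a} {b} {x} x∈ with x ∈?[ a , b ⟩
... | yes _ = refl
... | no x∉ = ⊥-elim (x∉ x∈)

indicator-∉ : ∀ {a b x} → ¬ x ∈[ a , b ⟩ → indicator a b x ≡ 0ℤ
indicator-∉ {a} {b} {x} x∉ with x ∈?[ a , b ⟩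
... | yes x∈ = ⊥-elim (x∉ x∈)
... | no _ = refl

indicator-below : ∀ {a b x} → x < a → indicator a b x ≡ 0ℤ
indicator-below x<a = indicator-∉ λ (a≤x , _) → ℕ.<⇒≱ x<a a≤x

indicator-above : ∀ {a b x} → b ≤ x → indicator a b x ≡ 0ℤ
indicator-above b≤x = indicator-∉ λ (_ , x<b) → ℕ.<⇒≱ x<b b≤x

indicator-difference : ∀ {a b a′ b′ x} → a ≤ x → a′ ≤ x → b′ ≤ b →
  indicator a b x - indicator a′ b′ x ≡ indicator b′ b x
indicator-difference {a} {b} {a′} {b′} {x} a≤x a′≤x b′≤b with ℕ.≤-<-connex b′ x | ℕ.≤-<-connex b x
... | inj₂ x<b′ | _
  rewrite indicator-∈ (a≤x , ℕ.<-≤-trans x<b′ b′≤b) | indicator-∈ (a′≤x , x<b′)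
        | indicator-below {b = b} x<b′ = refl
... | inj₁ b′≤x | inj₂ x<b
  rewrite indicator-∈ (a≤x , x<b) | indicator-above {a′} b′≤x | indicator-∈ (b′≤x , x<b) = refl
... | inj₁ b′≤x | inj₁ b≤x
  rewrite indicator-above {a} b≤x | indicator-above {a′} b′≤x | indicator-above {b′} b≤x = refl

-- Up to signs of rows and columns, column c is the indicator of the rows whose rank lies in
-- [lower c, upper c⟩: the consecutive-ones property for columns once rows are sorted by rank.
record IntervalMatrix {m n} (M : Matrix m n) : Set where
  field
    rank         : Fin m → ℕ
    rowSign      : Fin m → ℤ
    colSign      : Fin n → ℤ
    lower upper  : Fin n → ℕ
    rowSign-unit : ∀ r → IsUnit (rowSign r)
    colSign-unit : ∀ c → IsUnit (colSign c)
    entry        : ∀ r c → M r c ≡ colSign c * (rowSign r * indicator (lower c) (upper c) (rank r))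

submatrix-IntervalMatrix : ∀ {m n k} {M : Matrix m n} → IntervalMatrix M →
  (ρ : Fin k → Fin m) (κ : Fin k → Fin n) → IntervalMatrix (submatrix M ρ κ)
submatrix-IntervalMatrix I ρ κ = record
  { rank = rank ∘ ρ ; rowSign = rowSign ∘ ρ ; colSign = colSign ∘ κ
  ; lower = lower ∘ κ ; upper = upper ∘ κ
  ; rowSign-unit = rowSign-unit ∘ ρ ; colSign-unit = colSign-unit ∘ κ
  ; entry = λ r c → entry (ρ r) (κ c)
  }
  where open IntervalMatrix I

cancel-unit : ∀ {u} → IsUnit u → ∀ τ σ i i′ →
  τ * (σ * i) + - (τ * u) * (u * (σ * i′)) ≡ τ * (σ * (i - i′))
cancel-unit {u} u-unit τ σ i i′ = begin
  τ * (σ * i) + - (τ * u) * (u * (σ * i′))  ≡⟨ factor τ u σ i i′ ⟩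
  τ * (σ * i) + - (τ * (σ * i′)) * (u * u)
    ≡⟨ cong (λ s → τ * (σ * i) + - (τ * (σ * i′)) * s) (IsUnit⇒square≡1 u-unit) ⟩
  τ * (σ * i) + - (τ * (σ * i′)) * 1ℤ       ≡⟨ collect τ σ i i′ ⟩
  τ * (σ * (i - i′))                        ∎
  where
  factor : ∀ τ u σ i i′ →
    τ * (σ * i) + - (τ * u) * (u * (σ * i′)) ≡ τ * (σ * i) + - (τ * (σ * i′)) * (u * u)
  factor = solve-∀
  collect : ∀ τ σ i i′ → τ * (σ * i) + - (τ * (σ * i′)) * 1ℤ ≡ τ * (σ * (i - i′))
  collect = solve-∀

-- Pivot on a row r* of least rank x* and, among the columns whose interval contains x*, on one
-- column j* whose interval ends first. As no row has rank below x*, subtracting (up to sign) column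
-- j* from another column through x* with interval [l, u⟩ leaves the interval [upper j*, u⟩, which
-- misses x*.
module Pivot {k} {M : Matrix (suc k) (suc k)} (I : IntervalMatrix M) where
  open IntervalMatrix I

  r* : Fin (suc k)
  r* = proj₁ (minimum rank)

  x* : ℕ
  x* = rank r*

  r*-minimal : ∀ r → x* ≤ rank r
  r*-minimal = proj₂ (minimum rank)

  module Eliminate (j* : Fin (suc k)) (j*-covers : x* ∈[ lower j* , upper j* ⟩)
                   (j*-minimal : ∀ c → x* ∈[ lower c , upper c ⟩ → upper j* ≤ upper c) where

    eliminated? : ∀ c → Dec (x* ∈[ lower c , upper c ⟩ × c ≢ j*)
    eliminated? c = x* ∈?[ lower c , upper c ⟩ ×-dec ¬? (c Fin.≟ j*)

    coefficient : Fin (suc k) → ℤ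
    coefficient c with eliminated? c
    ... | yes _ = - (colSign c * colSign j*)
    ... | no _ = 0ℤ

    lower′ : Fin (suc k) → ℕ
    lower′ c with eliminated? c
    ... | yes _ = upper j*
    ... | no _ = lower c

    M′ : Matrix (suc k) (suc k)
    M′ = addColumnMultiples M j* coefficient

    det-M′ : det M′ ≡ det M
    det-M′ = det-addColumnMultiples M j* coefficient coefficient-j*
      where
      coefficient-j* : coefficient j* ≡ 0ℤ
      coefficient-j* with eliminated? j*
      ... | yes (_ , j*≢j*) = ⊥-elim (j*≢j* refl)
      ... | no _ = refl

    M′-entry : ∀ r c → M′ r c ≡ colSign c * (rowSign r * indicator (lower′ c) (upper c) (rank r))
    M′-entry r c with eliminated? c
    ... | yes ((lower≤x* , x*<upper) , _) = begin
      M r c + - (colSign c * colSign j*) * M r j*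
        ≡⟨ cong₂ (λ x y → x + - (colSign c * colSign j*) * y) (entry r c) (entry r j*) ⟩
      colSign c * (rowSign r * i)
        + - (colSign c * colSign j*) * (colSign j* * (rowSign r * i*))
        ≡⟨ cancel-unit (colSign-unit j*) (colSign c) (rowSign r) i i* ⟩
      colSign c * (rowSign r * (i - i*))
        ≡⟨ cong (λ z → colSign c * (rowSign r * z))
                (indicator-difference (ℕ.≤-trans lower≤x* (r*-minimal r))
                                      (ℕ.≤-trans (proj₁ j*-covers) (r*-minimal r))
                                      (j*-minimal c (lower≤x* , x*<upper))) ⟩
      colSign c * (rowSign r * indicator (upper j*) (upper c) (rank r)) ∎
      where
      i = indicator (lower c) (upper c) (rank r)
      i* = indicator (lower j*) (upper j*) (rank r)
    ... | no _ = trans (+-identityʳ (M r c)) (entry r c)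

    M′-IntervalMatrix : IntervalMatrix M′
    M′-IntervalMatrix = record
      { rank = rank ; rowSign = rowSign ; colSign = colSign ; lower = lower′ ; upper = upper
      ; rowSign-unit = rowSign-unit ; colSign-unit = colSign-unit ; entry = M′-entry }

    M′-pivotRow : ∀ c → c ≢ j* → M′ r* c ≡ 0ℤ
    M′-pivotRow c c≢j* = trans (M′-entry r* c) (*-*-zeroʳ (colSign c) (rowSign r*) outside)
      where
      outside : indicator (lower′ c) (upper c) x* ≡ 0ℤ
      outside with eliminated? c
      ... | yes _ = indicator-below (proj₂ j*-covers)
      ... | no not-eliminated = indicator-∉ λ covers → not-eliminated (covers , c≢j*)

    M′-pivot : M′ r* j* ≡ colSign j* * rowSign r*
    M′-pivot = begin
      M′ r* j*                                                    ≡⟨ M′-entry r* j* ⟩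
      colSign j* * (rowSign r* * indicator (lower′ j*) (upper j*) x*)
        ≡⟨ cong (λ z → colSign j* * (rowSign r* * z)) inside ⟩
      colSign j* * (rowSign r* * 1ℤ)                              ≡⟨ cong (colSign j* *_) (*-identityʳ (rowSign r*)) ⟩
      colSign j* * rowSign r*                                     ∎
      where
      inside : indicator (lower′ j*) (upper j*) x* ≡ 1ℤ
      inside with eliminated? j*
      ... | yes (_ , j*≢j*) = ⊥-elim (j*≢j* refl)
      ... | no _ = indicator-∈ j*-covers

  reduce : det M ≡ 0ℤ ⊎ ∃[ N ] (IntervalMatrix {k} N × ∃[ u ] (IsUnit u × det M ≡ u * det N))
  reduce with minimumOn (λ c → x* ∈?[ lower c , upper c ⟩) upper
  ... | inj₁ none-covers = inj₁ (det-zeroRow M r* λ c →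
    trans (entry r* c) (*-*-zeroʳ (colSign c) (rowSign r*) (indicator-∉ (none-covers c))))
  ... | inj₂ (j* , j*-covers , j*-minimal) =
    inj₂ (minor M′ r* j* , submatrix-IntervalMatrix M′-IntervalMatrix (punchIn r*) (punchIn j*) ,
          s * p , IsUnit-* (IsUnit-* (IsUnit-sgn (toℕ r*)) (IsUnit-sgn (toℕ j*)))
                           (IsUnit-* (colSign-unit j*) (rowSign-unit r*)) ,
          expansion)
    where
    open Eliminate j* j*-covers j*-minimal
    s = sgn (toℕ r*) * sgn (toℕ j*)
    p = colSign j* * rowSign r*
    expansion : det M ≡ s * p * det (minor M′ r* j*)
    expansion = begin
      det M                                     ≡⟨ det-M′ ⟨
      det M′                                    ≡⟨ det-singleEntryRow M′ r* j* M′-pivotRow ⟩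
      s * (M′ r* j* * det (minor M′ r* j*))     ≡⟨ cong (λ x → s * (x * det (minor M′ r* j*))) M′-pivot ⟩
      s * (p * det (minor M′ r* j*))            ≡⟨ *-assoc s p _ ⟨
      s * p * det (minor M′ r* j*)              ∎

det-IntervalMatrix : ∀ {k} {M : Matrix k k} → IntervalMatrix M → ZeroOrUnit (det M)
det-IntervalMatrix {zero} _ = inj₂ (inj₁ refl)
det-IntervalMatrix {suc k} I with Pivot.reduce I
... | inj₁ det≡0 = inj₁ det≡0
... | inj₂ (N , I′ , u , u-unit , det≡u*detN) =
  subst ZeroOrUnit (sym det≡u*detN) (ZeroOrUnit-* u-unit (det-IntervalMatrix I′))

IntervalMatrix⇒TotallyUnimodular : ∀ {m n} {M : Matrix m n} → IntervalMatrix M → TotallyUnimodular M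
IntervalMatrix⇒TotallyUnimodular I k ρ κ _ _ = det-IntervalMatrix (submatrix-IntervalMatrix I ρ κ)

-- The block matrix

opposite-injective : ∀ {n} {i j : Fin n} → toℕ (opposite i) ≡ toℕ (opposite j) → i ≡ j
opposite-injective {i = i} {j} eq = begin
  i                     ≡⟨ Fin.opposite-involutive i ⟨
  opposite (opposite i) ≡⟨ cong opposite (Fin.toℕ-injective eq) ⟩
  opposite (opposite j) ≡⟨ Fin.opposite-involutive j ⟩
  j                     ∎

opposite-antimono-≤ : ∀ {n} {i j : Fin n} → toℕ i ≤ toℕ j → toℕ (opposite j) ≤ toℕ (opposite i)
opposite-antimono-≤ {n} {i} {j} i≤j
  rewrite Fin.opposite-prop i | Fin.opposite-prop j = ℕ.∸-monoʳ-≤ n (s≤s i≤j)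

opposite-antimono-< : ∀ {n} {i j : Fin n} → toℕ i < toℕ j → toℕ (opposite j) < toℕ (opposite i)
opposite-antimono-< {n} {i} {j} i<j
  rewrite Fin.opposite-prop i | Fin.opposite-prop j = ℕ.∸-monoʳ-< (s≤s i<j) (Fin.toℕ<n j)

identity-indicator : ∀ {m} (rk : Fin m → ℕ) → (∀ {i j} → rk i ≡ rk j → i ≡ j) →
  ∀ {u} → IsUnit u → ∀ i j → identity i j ≡ u * (u * indicator (rk j) (suc (rk j)) (rk i))
identity-indicator rk rk-injective {u} u-unit i j with i Fin.≟ j
... | yes refl = begin
  1ℤ                                              ≡⟨ IsUnit⇒square≡1 u-unit ⟨
  u * u                                           ≡⟨ cong (u *_) (*-identityʳ u) ⟨
  u * (u * 1ℤ)                                    ≡⟨ cong (λ z → u * (u * z)) (indicator-∈ same-rank) ⟨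
  u * (u * indicator (rk i) (suc (rk i)) (rk i))  ∎
  where
  same-rank : rk i ∈[ rk i , suc (rk i) ⟩
  same-rank = ℕ.≤-refl , ℕ.n<1+n (rk i)
... | no i≢j = sym (*-*-zeroʳ u u (indicator-∉ other-rank))
  where
  other-rank : ¬ rk i ∈[ rk j , suc (rk j) ⟩
  other-rank (rkj≤rki , rki<1+rkj) = i≢j (rk-injective (ℕ.≤-antisym (ℕ.≤-pred rki<1+rkj) rkj≤rki))

costMatrix-opposite : ∀ {K n} (o : OrdinalObjective K n) {U} → K ≤ U → ∀ t x →
  indicator (toℕ (opposite (o x))) U (toℕ (opposite t)) ≡ costMatrix o t x
costMatrix-opposite o K≤U t x with t Fin.≤? o x
... | yes t≤o = indicator-∈ (opposite-antimono-≤ t≤o , ℕ.<-≤-trans (Fin.toℕ<n (opposite t)) K≤U)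
... | no t≰o = indicator-below (opposite-antimono-< (ℕ.≰⇒> t≰o))

costMatrix-shift : ∀ {K n} (o : OrdinalObjective K n) {L} K′ → L ≤ K′ → ∀ b x →
  indicator L (K′ ℕ.+ suc (toℕ (o x))) (K′ ℕ.+ toℕ b) ≡ costMatrix o b x
costMatrix-shift o K′ L≤K′ b x with b Fin.≤? o x
... | yes b≤o = indicator-∈ (ℕ.≤-trans L≤K′ (ℕ.m≤m+n K′ (toℕ b)) , ℕ.+-monoʳ-< K′ (s≤s b≤o))
... | no b≰o = indicator-above (ℕ.+-monoʳ-≤ K′ (ℕ.≰⇒> b≰o))

-- unit a is a itself for a = ±1 and 1 for a = 0; a factor 0 is encoded by an empty interval instead.
unit : ℤ → ℤ
unit +0 = 1ℤ
unit a = a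

ifNonzero : ℤ → ℕ → ℕ → ℕ
ifNonzero +0 _ y = y
ifNonzero _ x _ = x

IsUnit-unit : ∀ {a} → InSignSet a → IsUnit (unit a)
IsUnit-unit (inj₁ refl) = inj₂ refl
IsUnit-unit (inj₂ (inj₁ refl)) = inj₁ refl
IsUnit-unit (inj₂ (inj₂ refl)) = inj₁ refl

≤-ifNonzero : ∀ a {x y z} → z ≤ x → z ≤ y → z ≤ ifNonzero a x y
≤-ifNonzero +0 _ z≤y = z≤y
≤-ifNonzero +[1+ _ ] z≤x _ = z≤x
≤-ifNonzero -[1+ _ ] z≤x _ = z≤x

ifNonzero-≤ : ∀ a {x y z} → x ≤ z → y ≤ z → ifNonzero a x y ≤ z
ifNonzero-≤ +0 _ y≤z = y≤z
ifNonzero-≤ +[1+ _ ] x≤z _ = x≤z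
ifNonzero-≤ -[1+ _ ] x≤z _ = x≤z

module Block (α β : ℤ) {n K̃ K̂ : ℕ} (õ : OrdinalObjective K̃ n) (ô : OrdinalObjective K̂ n) where

  rank : Fin (K̃ ℕ.+ K̂) → ℕ
  rank = [ toℕ ∘ opposite , (K̃ ℕ.+_) ∘ toℕ ]′ ∘ splitAt K̃

  rowSign : Fin (K̃ ℕ.+ K̂) → ℤ
  rowSign = [ const (unit α) , const (unit β) ]′ ∘ splitAt K̃

  costLower costUpper : Fin n → ℕ
  costLower x = ifNonzero α (toℕ (opposite (õ x))) K̃
  costUpper x = ifNonzero β (K̃ ℕ.+ suc (toℕ (ô x))) K̃

  costLower≤K̃ : ∀ x → costLower x ≤ K̃
  costLower≤K̃ x = ifNonzero-≤ α (ℕ.<⇒≤ (Fin.toℕ<n (opposite (õ x)))) ℕ.≤-refl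

  K̃≤costUpper : ∀ x → K̃ ≤ costUpper x
  K̃≤costUpper x = ≤-ifNonzero β (ℕ.m≤m+n K̃ _) ℕ.≤-refl

  colSign : Fin (n ℕ.+ (K̃ ℕ.+ K̂)) → ℤ
  colSign = [ const 1ℤ , rowSign ]′ ∘ splitAt n

  lower upper : Fin (n ℕ.+ (K̃ ℕ.+ K̂)) → ℕ
  lower = [ costLower , rank ]′ ∘ splitAt n
  upper = [ costUpper , suc ∘ rank ]′ ∘ splitAt n

  top-cost : InSignSet α → ∀ t x →
    α * costMatrix õ t x ≡ unit α * indicator (costLower x) (costUpper x) (toℕ (opposite t))
  top-cost (inj₁ refl) t x = cong (-1ℤ *_) (sym (costMatrix-opposite õ (K̃≤costUpper x) t x))
  top-cost (inj₂ (inj₂ refl)) t x = cong (1ℤ *_) (sym (costMatrix-opposite õ (K̃≤costUpper x) t x))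
  top-cost (inj₂ (inj₁ refl)) t x =
    sym (trans (*-identityˡ _) (indicator-below (Fin.toℕ<n (opposite t))))

  bottom-cost : InSignSet β → ∀ b x →
    β * costMatrix ô b x ≡ unit β * indicator (costLower x) (costUpper x) (K̃ ℕ.+ toℕ b)
  bottom-cost (inj₁ refl) b x = cong (-1ℤ *_) (sym (costMatrix-shift ô K̃ (costLower≤K̃ x) b x))
  bottom-cost (inj₂ (inj₂ refl)) b x = cong (1ℤ *_) (sym (costMatrix-shift ô K̃ (costLower≤K̃ x) b x))
  bottom-cost (inj₂ (inj₁ refl)) b x =
    sym (trans (*-identityˡ _) (indicator-above (ℕ.m≤m+n K̃ (toℕ b))))

  module _ (α∈ : InSignSet α) (β∈ : InSignSet β) where

    rowSign-unit : ∀ r → IsUnit (rowSign r)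
    rowSign-unit r with splitAt K̃ r
    ... | inj₁ _ = IsUnit-unit α∈
    ... | inj₂ _ = IsUnit-unit β∈

    colSign-unit : ∀ c → IsUnit (colSign c)
    colSign-unit c with splitAt n c
    ... | inj₁ _ = inj₁ refl
    ... | inj₂ s = rowSign-unit s

    entry : ∀ r c → blockMatrix α β (costMatrix õ) (costMatrix ô) r c ≡
      colSign c * (rowSign r * indicator (lower c) (upper c) (rank r))
    entry r c with splitAt K̃ r | splitAt n c
    ... | inj₁ t | inj₁ x = trans (top-cost α∈ t x) (sym (*-identityˡ _))
    ... | inj₂ b | inj₁ x = trans (bottom-cost β∈ b x) (sym (*-identityˡ _))
    ... | inj₁ t | inj₂ s with splitAt K̃ s
    ...   | inj₁ s̃ = identity-indicator (toℕ ∘ opposite) opposite-injective (IsUnit-unit α∈) t s̃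
    ...   | inj₂ ŝ = sym (*-*-zeroʳ (unit β) (unit α) (indicator-below t<ŝ))
      where t<ŝ = ℕ.<-≤-trans (Fin.toℕ<n (opposite t)) (ℕ.m≤m+n K̃ (toℕ ŝ))
    entry r c | inj₂ b | inj₂ s with splitAt K̃ s
    ...   | inj₁ s̃ = sym (*-*-zeroʳ (unit α) (unit β) (indicator-above s̃<b))
      where s̃<b = ℕ.≤-trans (Fin.toℕ<n (opposite s̃)) (ℕ.m≤m+n K̃ (toℕ b))
    ...   | inj₂ ŝ =
      identity-indicator ((K̃ ℕ.+_) ∘ toℕ) (Fin.toℕ-injective ∘ ℕ.+-cancelˡ-≡ K̃ _ _) (IsUnit-unit β∈) b ŝ

    blockMatrix-IntervalMatrix : IntervalMatrix (blockMatrix α β (costMatrix õ) (costMatrix ô))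
    blockMatrix-IntervalMatrix = record
      { rank = rank ; rowSign = rowSign ; colSign = colSign ; lower = lower ; upper = upper
      ; rowSign-unit = rowSign-unit ; colSign-unit = colSign-unit ; entry = entry }

corollary1 : (α β : ℤ) → InSignSet α → InSignSet β →
    (n K̃ K̂ : ℕ) (õ : OrdinalObjective K̃ n) (ô : OrdinalObjective K̂ n) →
    TotallyUnimodular (blockMatrix α β (costMatrix õ) (costMatrix ô))
corollary1 α β α∈ β∈ n K̃ K̂ õ ô =
  IntervalMatrix⇒TotallyUnimodular (Block.blockMatrix-IntervalMatrix α β õ ô α∈ β∈)
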